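{- Let $n\ge2$, $1\le r<n$ and $e\ge1$ be integers. Then the partitions $(n,r)\times[e,0]$ and $(n,n-r)\times[e,0]$ generate the same orbit of partitions under the extended Farey map.
   Context: For integers $a_1\ge a_2\ge1$ and $c_1,c_2\ge0$, $(a_1,a_2)\times[c_1,c_2]$ denotes the partition of $c_1a_1+c_2a_2$ with $c_1$ parts $a_1$ and $c_2$ parts $a_2$. $\tilde F_0((a_1,a_2)\times[c_1,c_2])=(a_2,a_1-a_2)\times[c_1+c_2,c_1]$, $\tilde F_1((a_1,a_2)\times[c_1,c_2])=(a_1-a_2,a_2)\times[c_1,c_1+c_2]$. The extended Farey map $\tilde F$ applies $\tilde F_0$ when $a_2\ge a_1-a_2$ and $\tilde F_1$ when $a_1-a_2\ge a_2$ (when $a_1=2a_2$, a fixed rule depending only on the current partition selects one). The Farey map is $F(x)=(1-x)/x$ on $[1/2,1]$, $F(x)=x/(1-x)$ on $[0,1/2]$; for $r/n$ in lowest terms $\mathrm{dep}(r/n)=\ell+1$ with $\ell\ge0$ least such that $F^\ell(r/n)=1/2$, and a non-reduced fraction has the depth of its reduced form. The orbit of partitions generated by $(n,r)\times[e,0]$ is the sequence $\tilde F^m((n,r)\times[e,0])$, $m=1,\dots,\mathrm{dep}(r/n)$. -}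

module Defs where

open import Data.Nat using (ℕ; zero; suc; _+_; _*_; _∸_; _<_; _≤ᵇ_; _≡ᵇ_)
open import Data.Bool using (Bool; true; false; if_then_else_)
open import Data.Product using (_×_; _,_)
open import Data.List using (List; map; upTo)
open import Function using (_∘_)
open import Relation.Binary.PropositionalEquality using (_≡_; _≢_)

iter : {A : Set} → (A → A) → ℕ → A → A
iter f zero    x = x
iter f (suc k) x = f (iter f k x)

record Part : Set where
  constructor ⟨_,_⟩×[_,_]
  field
    a₁ a₂ c₁ c₂ : ℕ

open Part public

F̃₀ : Part → Part
F̃₀ ⟨ a₁ , a₂ ⟩×[ c₁ , c₂ ] = ⟨ a₂ , a₁ ∸ a₂ ⟩×[ c₁ + c₂ , c₁ ]

F̃₁ : Part → Part
F̃₁ ⟨ a₁ , a₂ ⟩×[ c₁ , c₂ ] = ⟨ a₁ ∸ a₂ , a₂ ⟩×[ c₁ , c₁ + c₂ ]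

F̃ : (rule : Part → Bool) → Part → Part
F̃ rule p with a₁ p ≡ᵇ 2 * a₂ p
... | true  = if rule p then F̃₀ p else F̃₁ p
... | false = if suc (a₁ p ∸ a₂ p) ≤ᵇ a₂ p then F̃₀ p else F̃₁ p

orbit : (rule : Part → Bool) → Part → ℕ → List Part
orbit rule x d = map (λ m → iter (F̃ rule) (suc m) x) (upTo d)

-- Farey map on fractions p/q (0 < p ≤ q), represented by the pair (p , q)
-- (numerator, denominator); it computes the exact rational values
-- F(x) = (1-x)/x for x ≥ 1/2 and F(x) = x/(1-x) for x ≤ 1/2.

Farey : ℕ × ℕ → ℕ × ℕ
Farey (p , q) = if q ≤ᵇ 2 * p then (q ∸ p , p) else (p , q ∸ p)

IsHalf : ℕ × ℕ → Set
IsHalf (p , q) = 2 * p ≡ q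

-- dep(r/n) = d : d = ℓ + 1 with ℓ least such that F^ℓ(r/n) = 1/2.
-- (Stated on values, so a non-reduced fraction has the depth of its
-- reduced form automatically.)
IsDepth : ℕ → ℕ → ℕ → Set
IsDepth r n zero    = Data.Empty.⊥
  where import Data.Empty
IsDepth r n (suc ℓ) =
  IsHalf (iter Farey ℓ (r , n)) ×
  ((k : ℕ) → k < ℓ → IsHalf (iter Farey k (r , n)) → Data.Empty.⊥)
  where import Data.Empty

-- After one step of the Farey map, r/n and (n-r)/n both become min(r,n-r)/max(r,n-r),
-- and one step of the extended Farey map sends (n,r)×[e,0] and (n,n-r)×[e,0] both to
-- (max,min)×[e,e]; everything after the first step therefore coincides.  The depth is
-- finite because each Farey step away from 1/2 strictly decreases the denominator.
module Submission where

open import Defs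
open import Data.Nat using (ℕ; _≤_; _<_; _∸_; zero; suc; _+_; _*_; s≤s)
open import Data.Nat.Properties
open import Data.Bool using (Bool; true; false; T)
open import Data.Empty using (⊥; ⊥-elim)
open import Data.Product using (Σ; _×_; _,_; proj₂)
open import Data.List.Properties using (map-cong)
open import Function using (_∘_)
open import Data.Nat.Induction using (<-wellFounded)
open import Induction.WellFounded using (Acc; acc)
open import Relation.Nullary using (¬_; yes; no)
open import Relation.Binary using (tri<; tri≈; tri>)
open import Relation.Binary.PropositionalEquality

T⇒≡true : ∀ {b} → T b → b ≡ true
T⇒≡true {true} _ = refl

¬T⇒≡false : ∀ {b} → ¬ T b → b ≡ false
¬T⇒≡false {true}  ¬t = ⊥-elim (¬t _)
¬T⇒≡false {false} _  = refl

2*m<m+n : ∀ {m n} → m < n → 2 * m < m + n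
2*m<m+n {m} m<n rewrite +-identityʳ m = +-monoʳ-< m m<n

m+n<2*n : ∀ {m n} → m < n → m + n < 2 * n
m+n<2*n {n = n} m<n rewrite +-identityʳ n = +-monoˡ-< n m<n

iter-suc : {A : Set} (f : A → A) (k : ℕ) (x : A) → iter f (suc k) x ≡ iter f k (f x)
iter-suc f zero    x = refl
iter-suc f (suc k) x = cong f (iter-suc f k x)

iter-suc-cong : {A : Set} (f : A → A) {x y : A} → f x ≡ f y →
                ∀ k → iter f (suc k) x ≡ iter f (suc k) y
iter-suc-cong f fx≡fy zero    = fx≡fy
iter-suc-cong f fx≡fy (suc k) = cong f (iter-suc-cong f fx≡fy k)

Proper : ℕ × ℕ → Set
Proper (p , q) = 0 < p × p < q

Descended : ℕ × ℕ → ℕ × ℕ → Set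
Descended (_ , q) y = Proper y × proj₂ y < q

Farey-≤ : ∀ {p q} → q ≤ 2 * p → Farey (p , q) ≡ (q ∸ p , p)
Farey-≤ {p} {q} q≤2p rewrite T⇒≡true (≤⇒≤ᵇ q≤2p) = refl

Farey-> : ∀ {p q} → 2 * p < q → Farey (p , q) ≡ (p , q ∸ p)
Farey-> {p} {q} 2p<q rewrite ¬T⇒≡false (<⇒≱ 2p<q ∘ ≤ᵇ⇒≤ q (2 * p)) = refl

Farey-descent : ∀ {x} → Proper x → ¬ IsHalf x →
                Proper (Farey x) × proj₂ (Farey x) < proj₂ x
Farey-descent {p , q} (0<p , p<q) not-half with q ≤? 2 * p
... | yes q≤2p = subst (Descended (p , q)) (sym (Farey-≤ q≤2p))
                       ((m<n⇒0<n∸m p<q , q∸p<p) , p<q)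
  where
  q<p+p : q < p + p
  q<p+p = subst (q <_) (cong (p +_) (+-identityʳ p)) (≤∧≢⇒< q≤2p (not-half ∘ sym))
  q∸p<p : q ∸ p < p
  q∸p<p = subst (q ∸ p <_) (m+n∸n≡m p p) (∸-monoˡ-< q<p+p (<⇒≤ p<q))
... | no q≰2p = subst (Descended (p , q)) (sym (Farey-> (≰⇒> q≰2p)))
                       ((0<p , p<q∸p) , ∸-monoʳ-< 0<p (<⇒≤ p<q))
  where
  p+p<q : p + p < q
  p+p<q = subst (_< q) (cong (p +_) (+-identityʳ p)) (≰⇒> q≰2p)
  p<q∸p : p < q ∸ p
  p<q∸p = subst (_< q ∸ p) (m+n∸n≡m p p) (∸-monoˡ-< p+p<q (m≤n+m p p))

Depth : ℕ × ℕ → ℕ → Set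
Depth (p , q) = IsDepth p q

Depth-suc : ∀ {x} d → ¬ IsHalf x → Depth (Farey x) d → Depth x (suc d)
Depth-suc {x} (suc ℓ) not-half (half , before-half) =
  subst IsHalf (sym (iter-suc Farey ℓ x)) half , minimal
  where
  minimal : ∀ k → k < suc ℓ → IsHalf (iter Farey k x) → ⊥
  minimal zero    _         = not-half
  minimal (suc k) (s≤s k<ℓ) = before-half k k<ℓ ∘ subst IsHalf (iter-suc Farey k x)

Depth-pred : ∀ {x} d → ¬ IsHalf x → Depth x (suc d) → Depth (Farey x) d
Depth-pred {x} zero    not-half (half , _) = not-half half
Depth-pred {x} (suc ℓ) not-half (half , before-half) =
  subst IsHalf (iter-suc Farey ℓ x) half ,
  λ k k<ℓ → before-half (suc k) (s≤s k<ℓ) ∘ subst IsHalf (sym (iter-suc Farey k x))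

Depth-transfer : ∀ {x y} d → ¬ IsHalf x → ¬ IsHalf y → Farey x ≡ Farey y →
                 Depth x d → Depth y d
Depth-transfer {x} {y} (suc d) x-not-half y-not-half Fx≡Fy depth =
  Depth-suc d y-not-half (subst (λ z → Depth z d) Fx≡Fy (Depth-pred d x-not-half depth))

depth-exists : ∀ {x} → Proper x → Σ ℕ (Depth x)
depth-exists {x} proper = go proper (<-wellFounded (proj₂ x))
  where
  go : ∀ {x} → Proper x → Acc _<_ (proj₂ x) → Σ ℕ (Depth x)
  go {p , q} proper (acc smaller) with 2 * p ≟ q
  ... | yes half = 1 , half , λ _ ()
  ... | no not-half =
    let (proper′ , descent) = Farey-descent proper not-half
        (d , depth) = go proper′ (smaller descent)
    in suc d , Depth-suc d not-half depth

Farey-minor : ∀ {r s} → r < s → Farey (r , r + s) ≡ (r , s)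
Farey-minor {r} {s} r<s = trans (Farey-> (2*m<m+n r<s)) (cong (r ,_) (m+n∸m≡n r s))

Farey-major : ∀ {r s} → r < s → Farey (s , r + s) ≡ (r , s)
Farey-major {r} {s} r<s = trans (Farey-≤ (<⇒≤ (m+n<2*n r<s))) (cong (_, s) (m+n∸n≡m r s))

F̃-F̃₀ : ∀ rule {a b c d} → a ≢ 2 * b → a ∸ b < b →
       F̃ rule ⟨ a , b ⟩×[ c , d ] ≡ F̃₀ ⟨ a , b ⟩×[ c , d ]
F̃-F̃₀ rule {a} {b} a≢2b a∸b<b
  rewrite ¬T⇒≡false (a≢2b ∘ ≡ᵇ⇒≡ a (2 * b)) | T⇒≡true (≤⇒≤ᵇ a∸b<b) = refl

F̃-F̃₁ : ∀ rule {a b c d} → a ≢ 2 * b → b ≤ a ∸ b →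
       F̃ rule ⟨ a , b ⟩×[ c , d ] ≡ F̃₁ ⟨ a , b ⟩×[ c , d ]
F̃-F̃₁ rule {a} {b} a≢2b b≤a∸b
  rewrite ¬T⇒≡false (a≢2b ∘ ≡ᵇ⇒≡ a (2 * b))
        | ¬T⇒≡false (<⇒≱ (s≤s b≤a∸b) ∘ ≤ᵇ⇒≤ (suc (a ∸ b)) b) = refl

F̃-minor : ∀ rule e {r s} → r < s → F̃ rule ⟨ r + s , r ⟩×[ e , 0 ] ≡ ⟨ s , r ⟩×[ e , e ]
F̃-minor rule e {r} {s} r<s
  rewrite F̃-F̃₁ rule {c = e} {d = 0} (≢-sym (<⇒≢ (2*m<m+n r<s)))
                 (subst (r ≤_) (sym (m+n∸m≡n r s)) (<⇒≤ r<s))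
        | m+n∸m≡n r s | +-identityʳ e = refl

F̃-major : ∀ rule e {r s} → r < s → F̃ rule ⟨ r + s , s ⟩×[ e , 0 ] ≡ ⟨ s , r ⟩×[ e , e ]
F̃-major rule e {r} {s} r<s
  rewrite F̃-F̃₀ rule {c = e} {d = 0} (<⇒≢ (m+n<2*n r<s))
                 (subst (_< s) (sym (m+n∸n≡m r s)) r<s)
        | m+n∸n≡m r s | +-identityʳ e = refl

orbit-cong : ∀ rule {x y} → F̃ rule x ≡ F̃ rule y → ∀ d → orbit rule x d ≡ orbit rule y d
orbit-cong rule F̃x≡F̃y d = map-cong (iter-suc-cong (F̃ rule) F̃x≡F̃y) _

CommonOrbit : (Part → Bool) → ℕ → ℕ → ℕ → ℕ → Set
CommonOrbit rule n r s e =
  Σ ℕ (λ d → IsDepth r n d × IsDepth s n d ×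
    (orbit rule ⟨ n , r ⟩×[ e , 0 ] d ≡ orbit rule ⟨ n , s ⟩×[ e , 0 ] d))

CommonOrbit-sym : ∀ {rule n r s e} → CommonOrbit rule n r s e → CommonOrbit rule n s r e
CommonOrbit-sym (d , depth-r , depth-s , same) = d , depth-s , depth-r , sym same

CommonOrbit-from-first-step : ∀ rule e {n r s} d → ¬ IsHalf (r , n) → ¬ IsHalf (s , n) →
  Farey (r , n) ≡ Farey (s , n) → F̃ rule ⟨ n , r ⟩×[ e , 0 ] ≡ F̃ rule ⟨ n , s ⟩×[ e , 0 ] →
  IsDepth r n d → CommonOrbit rule n r s e
CommonOrbit-from-first-step rule e d r-not-half s-not-half Farey-agrees F̃-agrees depth =
  d , depth , Depth-transfer d r-not-half s-not-half Farey-agrees depth ,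
  orbit-cong rule F̃-agrees d

complement-common-orbit-< : ∀ rule e {r s} → 0 < r → r < s → CommonOrbit rule (r + s) r s e
complement-common-orbit-< rule e {r} {s} 0<r r<s =
  let (d , depth) = depth-exists (0<r , m<m+n r (<-trans 0<r r<s))
  in CommonOrbit-from-first-step rule e d
       (<⇒≢ (2*m<m+n r<s)) (≢-sym (<⇒≢ (m+n<2*n r<s)))
       (trans (Farey-minor r<s) (sym (Farey-major r<s)))
       (trans (F̃-minor rule e r<s) (sym (F̃-major rule e r<s)))
       depth

complement-common-orbit : ∀ rule e {r s} → 0 < r → 0 < s → CommonOrbit rule (r + s) r s e
complement-common-orbit rule e {r} {s} 0<r 0<s with <-cmp r s
... | tri< r<s _ _ = complement-common-orbit-< rule e 0<r r<s
... | tri≈ _ refl _ =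
  let (d , depth) = depth-exists (0<r , m<m+n r 0<r) in d , depth , depth , refl
... | tri> _ _ s<r =
  CommonOrbit-sym (subst (λ n → CommonOrbit rule n s r e) (+-comm s r)
                         (complement-common-orbit-< rule e 0<s s<r))

proposition4p15 : (rule : Part → Bool) (n r e : ℕ) → 2 ≤ n → 1 ≤ r → r < n → 1 ≤ e →
    Σ ℕ (λ d → IsDepth r n d × IsDepth (n ∸ r) n d ×
    (orbit rule ⟨ n , r ⟩×[ e , 0 ] d ≡ orbit rule ⟨ n , n ∸ r ⟩×[ e , 0 ] d))
proposition4p15 rule n r e _ 1≤r r<n _ =
  subst (λ m → CommonOrbit rule m r (n ∸ r) e) (m+[n∸m]≡n (<⇒≤ r<n))
        (complement-common-orbit rule e 1≤r (m<n⇒0<n∸m r<n))
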